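{- Let $n\geq 3$ be an integer, let $q_1,\dots,q_n,r_1,\dots,r_n$ be positive integers, let $G\cong K_{n,n}^{ -M}(q_1,\dots,q_n,r_1,\dots,r_n)$, and let $H$ be a graph without a universal vertex. Then $${\rm dim}_s(G\diamond H)=\sum_{i=1}^n{\left(t_i(G)\sum_{j=1}^{k(H)}{t_j(H)}\right)}-n\,k(H).$$
   Context: All graphs are simple. The modular product $G\diamond H$ has vertex set $V(G)\times V(H)$, and $(g,h)$, $(g',h')$ are adjacent if $g=g'$ and $hh'\in E(H)$, or $gg'\in E(G)$ and $h=h'$, or $gg'\in E(G)$ and $hh'\in E(H)$, or ($g\neq g'$, $h\neq h'$) $gg'\notin E(G)$ and $hh'\notin E(H)$. ${\rm dim}_s(X)$ is the strong metric dimension of a connected graph $X$ (minimum size of a set $S$ such that every two vertices $x,y$ are strongly resolved by some $z\in S$, i.e. $x$ lies on a $y,z$-geodesic or $y$ lies on an $x,z$-geodesic). A universal vertex is a vertex adjacent to all other vertices. Vertices $u,v$ are twins if $N[u]=N[v]$ (closed neighborhoods); this is an equivalence relation. A pair $\{g,g'\}$ is a $\gamma_G$-pair if $N_G[g]\cap N_G[g']=\emptyset$ and $N_G[g]\cup N_G[g']=V(G)$ (a dominating set of size two with $d_G(g,g')=3$). $K_{n,n}^{ -M}$ is $K_{n,n}$ with parts $\{x_1,\dots,x_n\}$, $\{y_1,\dots,y_n\}$ minus the perfect matching $M=\{x_iy_i:i\in[n]\}$; $K_{n,n}^{ -M}(q_1,\dots,q_n,r_1,\dots,r_n)$ is obtained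 from it by replacing each $x_i$ by a clique on $q_i\geq 1$ vertices and each $y_i$ by a clique on $r_i\geq 1$ vertices (every vertex then lies in a $\gamma$-pair). For a graph $H$, let $[h_1],\dots,[h_\ell]$ be its twin classes, ordered so that $h_1,\dots,h_k$ ($k\in\{0,\dots,\ell\}$) do not belong to any $\gamma_H$-pair and the remaining classes satisfy that $\{h_{k+i},h_{\ell-i+1}\}$ is a $\gamma_H$-pair for each $i\in[\frac{\ell-k}{2}]$. Set $T_i(H)=[h_i]$ for $i\in[k]$, $T_{k+i}(H)=[h_{k+i}]\cup[h_{\ell-i+1}]$ for $i\in[\frac{\ell-k}{2}]$, $t_i(H)=|T_i(H)|$, and $k(H)=k+\frac{\ell-k}{2}$. For $G\cong K_{n,n}^{ -M}(q_1,\dots,q_n,r_1,\dots,r_n)$ one has $k(G)=n$ and $t_i(G)=q_i+r_i$ for $i\in[n]$. -}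

module Defs where

open import Data.Nat using (ℕ; zero; suc; _+_; _*_; _≤_; _<ᵇ_)
open import Data.Fin using (Fin; zero; suc; toℕ; _≟_; remQuot)
open import Data.Bool using (Bool; true; false; _∧_; _∨_; not; _xor_; if_then_else_)
open import Data.Product using (Σ; ∃; _×_; _,_; proj₁; proj₂)
open import Data.Sum using (_⊎_)
open import Data.Fin.Subset using (Subset; _∈_; ∣_∣)
open import Relation.Nullary using (¬_)
open import Relation.Nullary.Decidable using (⌊_⌋)
open import Relation.Binary.PropositionalEquality using (_≡_; _≢_)

anyF : ∀ {N} → (Fin N → Bool) → Bool
anyF {zero}  f = false
anyF {suc N} f = f zero ∨ anyF (λ i → f (suc i))

allF : ∀ {N} → (Fin N → Bool) → Bool
allF {zero}  f = true
allF {suc N} f = f zero ∧ allF (λ i → f (suc i))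

sumF : ∀ {N} → (Fin N → ℕ) → ℕ
sumF {zero}  f = 0
sumF {suc N} f = f zero + sumF (λ i → f (suc i))

countF : ∀ {N} → (Fin N → Bool) → ℕ
countF f = sumF (λ i → if f i then 1 else 0)

_==_ : ∀ {N} → Fin N → Fin N → Bool
u == v = ⌊ u ≟ v ⌋

Graph : ℕ → Set
Graph N = Fin N → Fin N → Bool

record IsSimple {N : ℕ} (E : Graph N) : Set where
  field
    symmetric   : ∀ u v → E u v ≡ E v u
    irreflexive : ∀ u → E u u ≡ false

Universal : ∀ {N} → Graph N → Fin N → Set
Universal E v = ∀ u → u ≢ v → E v u ≡ true

NoUniversalVertex : ∀ {N} → Graph N → Set
NoUniversalVertex E = ∀ v → ¬ Universal E v

-- Modular product; vertex (g , h) of V(G) × V(H) is encoded in Fin (a * b)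
-- via remQuot (the standard bijection Fin (a * b) ≅ Fin a × Fin b).

adjPair : ∀ {a b} → Graph a → Graph b → Fin a × Fin b → Fin a × Fin b → Bool
adjPair EG EH (g , h) (g' , h') =
  ((g == g') ∧ EH h h')
  ∨ (EG g g' ∧ (h == h'))
  ∨ (EG g g' ∧ EH h h')
  ∨ (not (g == g') ∧ not (h == h') ∧ not (EG g g') ∧ not (EH h h'))

modular : ∀ {a b} → Graph a → Graph b → Graph (a * b)
modular {a} {b} EG EH x y = adjPair EG EH (remQuot b x) (remQuot b y)

reach : ∀ {N} → Graph N → ℕ → Fin N → Fin N → Bool
reach E zero    u v = u == v
reach E (suc k) u v = anyF (λ w → E u w ∧ reach E k w v)

distFrom : ∀ {N} → Graph N → ℕ → ℕ → Fin N → Fin N → ℕ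
distFrom E zero       k u v = k
distFrom E (suc fuel) k u v = if reach E k u v then k else distFrom E fuel (suc k) u v

-- d(u,v): the length of a shortest u,v-walk (= u,v-path); in a connected
-- graph on N vertices this is < N, so N tries suffice.
dist : ∀ {N} → Graph N → Fin N → Fin N → ℕ
dist {N} E u v = distFrom E N 0 u v

StronglyResolves : ∀ {N} → Graph N → Fin N → Fin N → Fin N → Set
StronglyResolves E z x y =
  (dist E y z ≡ dist E y x + dist E x z) ⊎ (dist E x z ≡ dist E x y + dist E y z)

IsStrongResolvingSet : ∀ {N} → Graph N → Subset N → Set
IsStrongResolvingSet E S =
  ∀ x y → x ≢ y → ∃ λ z → (z ∈ S) × StronglyResolves E z x y

IsStrongMetricDim : ∀ {N} → Graph N → ℕ → Set
IsStrongMetricDim E m =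
  (Σ _ λ S → IsStrongResolvingSet E S × ∣ S ∣ ≡ m)
  × (∀ S → IsStrongResolvingSet E S → m ≤ ∣ S ∣)

closedAdj : ∀ {N} → Graph N → Fin N → Fin N → Bool
closedAdj E u w = (u == w) ∨ E u w

twinsB : ∀ {N} → Graph N → Fin N → Fin N → Bool
twinsB E u v = allF (λ w → not (closedAdj E u w xor closedAdj E v w))

-- {u,v} is a γ-pair: N[u] ∩ N[v] = ∅ and N[u] ∪ N[v] = V
gammaPairB : ∀ {N} → Graph N → Fin N → Fin N → Bool
gammaPairB E u v = allF (λ w → closedAdj E u w xor closedAdj E v w)

-- u and v lie in the same block T_i: same twin class, or their twin
-- classes form a γ-pair
sameBlockB : ∀ {N} → Graph N → Fin N → Fin N → Bool
sameBlockB E u v = twinsB E u v ∨ gammaPairB E u v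

isRep : ∀ {N} → Graph N → Fin N → Bool
isRep E v = allF (λ w → not ((toℕ w <ᵇ toℕ v) ∧ sameBlockB E w v))

blockSize : ∀ {N} → Graph N → Fin N → ℕ
blockSize E v = countF (λ w → sameBlockB E w v)

kBlocks : ∀ {N} → Graph N → ℕ
kBlocks E = countF (isRep E)

sumOverBlocks : ∀ {N} → Graph N → (ℕ → ℕ) → ℕ
sumOverBlocks E f = sumF (λ v → if isRep E v then f (blockSize E v) else 0)

-- G ≅ K_{n,n}^{-M}(q_1,…,q_n,r_1,…,r_n)
-- An isomorphism is given as a labelling c : V(G) → Fin n × Bool sending
-- each vertex to the vertex x_i (label (i , false)) or y_i (label (i , true))
-- it replaces; the fibre of x_i has q_i vertices and that of y_i has r_i.

blowAdj : ∀ {n N} → (Fin N → Fin n × Bool) → Fin N → Fin N → Bool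
blowAdj c u v =
  not (u == v) ∧
    ( ((proj₁ (c u) == proj₁ (c v)) ∧ not (proj₂ (c u) xor proj₂ (c v)))
    ∨ (not (proj₁ (c u) == proj₁ (c v)) ∧ (proj₂ (c u) xor proj₂ (c v))))

record IsKnnMinusM (n : ℕ) (q r : Fin n → ℕ) {N : ℕ} (E : Graph N) : Set where
  field
    label    : Fin N → Fin n × Bool
    sizeX    : ∀ i → countF (λ v → (proj₁ (label v) == i) ∧ not (proj₂ (label v))) ≡ q i
    sizeY    : ∀ i → countF (λ v → (proj₁ (label v) == i) ∧ proj₂ (label v)) ≡ r i
    adjacent : ∀ u v → E u v ≡ blowAdj label u v

{-# OPTIONS --safe #-}
module Submission where

-- In the modular product the closed-neighbourhood indicator is the XNOR of those of the factors,
-- so two vertices are twins or a γ-pair (lie in one block) exactly when their G-coordinates and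
-- their H-coordinates do; the blocks of G = K_{n,n}^{-M}(q,r) are the n sets T_i(G), so G ◇ H has
-- n·k(H) blocks.  G ◇ H has diameter 3, and a third vertex never strongly resolves two vertices of
-- one block, so a strong resolving set misses at most one vertex per block.  Conversely, leave out
-- one vertex x per block: its γ-partner z is at distance 3, and every y outside the block of x
-- shares a closed neighbour with z (if y ∈ N[x]) or with x (if y ∈ N[z]), so y lies on an
-- x,z-geodesic.  Finally Σ t_i(G) · Σ t_j(H) = |V(G)| |V(H)| since blocks partition vertex sets.

open import Defs
open import Data.Nat using (ℕ; _≤_; _*_; _∸_)
open import Data.Fin using (Fin)

open import Data.Bool using (Bool; true; false; not; _∧_; _∨_; _xor_; if_then_else_; T)
open import Data.Bool.Properties
  using ( xor-same; xor-assoc; xor-comm; xor-inverseʳ; xor-identityʳ; xor-annihilates-not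
        ; ∨-zeroʳ; ∨-identityʳ; not-involutive; not-injective; not-¬; not-distribˡ-xor; not-distribʳ-xor; ¬-not)
  renaming (_≟_ to _≟ᵇ_)
open import Data.Empty using (⊥; ⊥-elim)
open import Data.Fin using (zero; suc; toℕ; _≟_; remQuot; combine; _↑ˡ_; _↑ʳ_; punchIn; punchOut)
open import Data.Fin.Properties
  using ( toℕ-injective; injective⇒≤; suc-injective; punchInᵢ≢i; punchIn-injective; punchIn-punchOut
        ; remQuot-combine; combine-remQuot)
open import Data.Fin.Subset using (Subset; _∈_; ∣_∣)
open import Data.Nat using (zero; suc; _+_; _<_; _<ᵇ_; z≤n; s≤s)
open import Data.Nat.Properties
  using ( +-identityʳ; +-suc; +-assoc; *-identityʳ; *-zeroʳ; *-distribʳ-+; +-commutativeSemigroup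
        ; ≤-refl; ≤-reflexive; ≤-trans; ≤-antisym; ≤-pred; _≤?_; <-cmp; ≰⇒>; <⇒≱; n≤0⇒n≡0
        ; m≤m+n; m≤n+m; m≤n⇒m≤1+n; m≤n⇒m<n∨m≡n; +-mono-≤; +-monoˡ-≤; ∸-monoʳ-≤
        ; m+n∸n≡m; m+n∸m≡n; <⇒<ᵇ; <ᵇ⇒<; module ≤-Reasoning)
open import Algebra.Properties.CommutativeSemigroup +-commutativeSemigroup
  using () renaming (interchange to +-interchange)
open import Data.Product using (Σ-syntax; ∃; _×_; _,_; proj₁; proj₂)
open import Data.Sum using (_⊎_; inj₁; inj₂)
open import Data.Vec using ([]; _∷_; lookup; tabulate)
open import Data.Vec.Properties using (lookup∘tabulate; lookup⇒[]=; []=⇒lookup)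
open import Function using (_∘_)
open import Relation.Binary.PropositionalEquality
open import Relation.Binary.Definitions using (tri<; tri≈; tri>)
open import Relation.Nullary using (¬_; yes; no; contradiction)

xor-cancelˡ : ∀ c {a b} → c xor a ≡ b → a ≡ c xor b
xor-cancelˡ c {a} refl = begin
  a                   ≡⟨ cong (_xor a) (xor-same c) ⟨
  (c xor c) xor a     ≡⟨ xor-assoc c c a ⟩
  c xor (c xor a)     ∎
  where open ≡-Reasoning

xor-xor : ∀ s a → s xor (s xor a) ≡ a
xor-xor s a = sym (xor-cancelˡ s refl)

xnor-solveʳ : ∀ c a {b} → not (c xor a) ≡ b → a ≡ not c xor b
xnor-solveʳ c a eq = xor-cancelˡ (not c) (trans (sym (not-distribˡ-xor c a)) eq)

xnor-solveˡ : ∀ a c {b} → not (a xor c) ≡ b → a ≡ not c xor b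
xnor-solveˡ a c eq = xnor-solveʳ c a (trans (cong not (xor-comm c a)) eq)

not-xor-true : ∀ a → not (a xor true) ≡ a
not-xor-true a = trans (not-distribʳ-xor a true) (xor-identityʳ a)

xnor-≡ : ∀ {a b} → a ≡ b → not (a xor b) ≡ true
xnor-≡ {a} refl = cong not (xor-same a)

∧-true : ∀ {a b} → (a ∧ b) ≡ true → a ≡ true × b ≡ true
∧-true {true} {true} _ = refl , refl

xnor⇒≡ : ∀ {a b} → not (a xor b) ≡ true → b ≡ a
xnor⇒≡ {false} {false} _ = refl
xnor⇒≡ {true}  {true}  _ = refl

xor⇒≡not : ∀ {a b} → (a xor b) ≡ true → b ≡ not a
xor⇒≡not {false} {true} _ = refl
xor⇒≡not {true} {false} _ = refl

xor-false⇒≡ : ∀ {a b} → (a xor b) ≡ false → a ≡ b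
xor-false⇒≡ {false} {false} _ = refl
xor-false⇒≡ {true}  {true}  _ = refl

==-refl : ∀ {N} (u : Fin N) → (u == u) ≡ true
==-refl u with u ≟ u
... | yes _   = refl
... | no u≢u  = contradiction refl u≢u

≡⇒== : ∀ {N} {u v : Fin N} → u ≡ v → (u == v) ≡ true
≡⇒== {u = u} refl = ==-refl u

==-≢ : ∀ {N} {u v : Fin N} → u ≢ v → (u == v) ≡ false
==-≢ {u = u} {v} u≢v with u ≟ v
... | yes u≡v = contradiction u≡v u≢v
... | no _    = refl

==⇒≡ : ∀ {N} {u v : Fin N} → (u == v) ≡ true → u ≡ v
==⇒≡ {u = u} {v} eq with u ≟ v
... | yes u≡v = u≡v
==⇒≡ () | no _

==-sym : ∀ {N} (u v : Fin N) → (u == v) ≡ (v == u)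
==-sym u v with u ≟ v
... | yes refl = sym (==-refl u)
... | no u≢v   = sym (==-≢ (u≢v ∘ sym))

avoid-two : ∀ {n} → 3 ≤ n → (i j : Fin n) → ∃ λ k → k ≢ i × k ≢ j
avoid-two (s≤s (s≤s (s≤s _))) i j with i ≟ j
... | yes refl = punchIn i zero , punchInᵢ≢i i zero , punchInᵢ≢i i zero
... | no i≢j   = punchIn i (punchIn j′ zero) , punchInᵢ≢i i _ , λ k≡j →
  punchInᵢ≢i j′ zero (punchIn-injective i _ _ (trans k≡j (sym (punchIn-punchOut i≢j))))
  where j′ = punchOut i≢j

anyF-intro : ∀ {N} (f : Fin N → Bool) w → f w ≡ true → anyF f ≡ true
anyF-intro f zero    fw rewrite fw = refl
anyF-intro f (suc w) fw with f zero
... | true  = refl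
... | false = anyF-intro (f ∘ suc) w fw

anyF-true : ∀ {N} (f : Fin N → Bool) → anyF f ≡ true → ∃ λ w → f w ≡ true
anyF-true {suc N} f any with f zero in f₀
... | true  = zero , f₀
... | false = let w , fw = anyF-true (f ∘ suc) any in suc w , fw

allF-intro : ∀ {N} (f : Fin N → Bool) → (∀ w → f w ≡ true) → allF f ≡ true
allF-intro {zero}  f all = refl
allF-intro {suc N} f all rewrite all zero = allF-intro (f ∘ suc) (all ∘ suc)

allF-true : ∀ {N} (f : Fin N → Bool) → allF f ≡ true → ∀ w → f w ≡ true
allF-true f all zero    = proj₁ (∧-true all)
allF-true f all (suc w) = allF-true (f ∘ suc) (proj₂ (∧-true {f zero} all)) w

allF-false : ∀ {N} (f : Fin N → Bool) → allF f ≡ false → ∃ λ w → f w ≡ false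
allF-false {suc N} f all with f zero in f₀
... | false = zero , f₀
... | true  = let w , fw = allF-false (f ∘ suc) all in suc w , fw

indicator : Bool → ℕ
indicator b = if b then 1 else 0

sumF-cong : ∀ {N} {f g : Fin N → ℕ} → (∀ i → f i ≡ g i) → sumF f ≡ sumF g
sumF-cong {zero}  f≗g = refl
sumF-cong {suc N} f≗g = cong₂ _+_ (f≗g zero) (sumF-cong (f≗g ∘ suc))

sumF-mono : ∀ {N} {f g : Fin N → ℕ} → (∀ i → f i ≤ g i) → sumF f ≤ sumF g
sumF-mono {zero}  f≤g = z≤n
sumF-mono {suc N} f≤g = +-mono-≤ (f≤g zero) (sumF-mono (f≤g ∘ suc))

sumF-const : ∀ N c → sumF {N} (λ _ → c) ≡ N * c
sumF-const zero    c = refl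
sumF-const (suc N) c = cong (c +_) (sumF-const N c)

sumF-zero : ∀ N → sumF {N} (λ _ → 0) ≡ 0
sumF-zero N = trans (sumF-const N 0) (*-zeroʳ N)

sumF-+ : ∀ {N} (f g : Fin N → ℕ) → sumF (λ i → f i + g i) ≡ sumF f + sumF g
sumF-+ {zero}  f g = refl
sumF-+ {suc N} f g = trans (cong (f zero + g zero +_) (sumF-+ (f ∘ suc) (g ∘ suc)))
                           (+-interchange (f zero) (g zero) _ _)

sumF-comm : ∀ {M N} (f : Fin M → Fin N → ℕ) →
            sumF (λ i → sumF (λ j → f i j)) ≡ sumF (λ j → sumF (λ i → f i j))
sumF-comm {zero}  {N} f = sym (sumF-zero N)
sumF-comm {suc M} {N} f = trans (cong (sumF (f zero) +_) (sumF-comm (f ∘ suc)))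
                                (sym (sumF-+ (f zero) _))

sumF-*ʳ : ∀ {N} (f : Fin N → ℕ) c → sumF (λ i → f i * c) ≡ sumF f * c
sumF-*ʳ {zero}  f c = refl
sumF-*ʳ {suc N} f c = trans (cong (f zero * c +_) (sumF-*ʳ (f ∘ suc) c))
                            (sym (*-distribʳ-+ c (f zero) _))

term≤sumF : ∀ {N} (f : Fin N → ℕ) k → f k ≤ sumF f
term≤sumF f zero    = m≤m+n _ _
term≤sumF f (suc k) = ≤-trans (term≤sumF (f ∘ suc) k) (m≤n+m _ (f zero))

sumF-↑ : ∀ m n (f : Fin (m + n) → ℕ) →
         sumF f ≡ sumF (λ i → f (i ↑ˡ n)) + sumF (λ j → f (m ↑ʳ j))
sumF-↑ zero    n f = refl
sumF-↑ (suc m) n f = trans (cong (f zero +_) (sumF-↑ m n (f ∘ suc))) (sym (+-assoc (f zero) _ _))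

sumF-combine : ∀ a b (f : Fin (a * b) → ℕ) →
               sumF f ≡ sumF {a} (λ g → sumF {b} (λ h → f (combine g h)))
sumF-combine zero    b f = refl
sumF-combine (suc a) b f = trans (sumF-↑ b (a * b) f)
                                 (cong (sumF (λ h → f (h ↑ˡ (a * b))) +_) (sumF-combine a b (f ∘ (b ↑ʳ_))))

countF-allFalse : ∀ {N} (f : Fin N → Bool) → (∀ i → f i ≡ false) → countF f ≡ 0
countF-allFalse {N} f allFalse = trans (sumF-cong (cong indicator ∘ allFalse)) (sumF-zero N)

countF≤1 : ∀ {N} (f : Fin N → Bool) → (∀ u v → f u ≡ true → f v ≡ true → u ≡ v) → countF f ≤ 1
countF≤1 {zero}  f unique = z≤n
countF≤1 {suc N} f unique with f zero in f₀
... | true  = ≤-reflexive (cong suc (countF-allFalse (f ∘ suc) others))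
  where
  others : ∀ i → f (suc i) ≡ false
  others i = ¬-not (λ fi → contradiction (unique zero (suc i) f₀ fi) λ ())
... | false = countF≤1 (f ∘ suc) (λ u v fu fv → suc-injective (unique (suc u) (suc v) fu fv))

countF≡1 : ∀ {N} (f : Fin N → Bool) w → f w ≡ true → (∀ v → f v ≡ true → v ≡ w) → countF f ≡ 1
countF≡1 f w fw unique = ≤-antisym
  (countF≤1 f (λ u v fu fv → trans (unique u fu) (sym (unique v fv))))
  (subst (_≤ countF f) (cong indicator fw) (term≤sumF _ w))

countF-positive : ∀ {N} (f : Fin N → Bool) → 1 ≤ countF f → ∃ λ w → f w ≡ true
countF-positive {suc N} f 1≤count with f zero in f₀
... | true  = zero , f₀
... | false = let w , fw = countF-positive (f ∘ suc) 1≤count in suc w , fw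

countF-not : ∀ {N} (f : Fin N → Bool) → countF f + countF (not ∘ f) ≡ N
countF-not {zero}  f = refl
countF-not {suc N} f with f zero
... | true  = cong suc (countF-not (f ∘ suc))
... | false = trans (+-suc _ _) (cong suc (countF-not (f ∘ suc)))

size≡countF : ∀ {N} (S : Subset N) → ∣ S ∣ ≡ countF (lookup S)
size≡countF []          = refl
size≡countF (true ∷ S)  = cong suc (size≡countF S)
size≡countF (false ∷ S) = size≡countF S

double-counting : ∀ {M N} (R : Fin M → Fin N → Bool) →
                  (∀ j → countF (λ i → R i j) ≡ 1) → sumF (λ i → countF (R i)) ≡ N
double-counting {N = N} R unique = begin
  sumF (λ i → countF (R i))                      ≡⟨ sumF-comm (λ i j → indicator (R i j)) ⟩
  sumF (λ j → countF (λ i → R i j))              ≡⟨ sumF-cong unique ⟩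
  sumF {N} (λ _ → 1)                             ≡⟨ sumF-const N 1 ⟩
  N * 1                                          ≡⟨ *-identityʳ N ⟩
  N                                              ∎
  where open ≡-Reasoning

countF-≤-matching : ∀ {M N} (p : Fin N → Bool) (q : Fin M → Bool) (R : Fin N → Fin M → Bool) →
                    (∀ v → p v ≡ true → ∃ λ m → q m ≡ true × R v m ≡ true) →
                    (∀ m → q m ≡ true → countF (λ v → p v ∧ R v m) ≤ 1) →
                    countF p ≤ countF q
countF-≤-matching {N = N} p q R matched atMostOne = begin
  countF p                                            ≤⟨ sumF-mono matches ⟩
  sumF (λ v → countF (λ m → q m ∧ (p v ∧ R v m)))
    ≡⟨ sumF-comm (λ v m → indicator (q m ∧ (p v ∧ R v m))) ⟩
  sumF (λ m → countF (λ v → q m ∧ (p v ∧ R v m)))     ≤⟨ sumF-mono fibre≤1 ⟩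
  countF q                                            ∎
  where
  open ≤-Reasoning
  matches : ∀ v → indicator (p v) ≤ countF (λ m → q m ∧ (p v ∧ R v m))
  matches v with p v in pv
  ... | false = z≤n
  ... | true with matched v pv
  ...   | m , qm , Rvm = subst (_≤ countF (λ m′ → q m′ ∧ R v m′)) (cong indicator (cong₂ _∧_ qm Rvm))
                                 (term≤sumF (λ m′ → indicator (q m′ ∧ R v m′)) m)
  fibre≤1 : ∀ m → countF (λ v → q m ∧ (p v ∧ R v m)) ≤ indicator (q m)
  fibre≤1 m with q m in qm
  ... | false = ≤-reflexive (sumF-zero N)
  ... | true  = atMostOne m qm

module _ {N} (E : Graph N) where

  closedAdj-refl : ∀ u → closedAdj E u u ≡ true
  closedAdj-refl u rewrite ==-refl u = refl

  adj⇒closedAdj : ∀ {u v} → E u v ≡ true → closedAdj E u v ≡ true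
  adj⇒closedAdj {u} {v} uv rewrite uv with u == v
  ... | true  = refl
  ... | false = refl

  adj≡closedAdj : ∀ {u v} → u ≢ v → E u v ≡ closedAdj E u v
  adj≡closedAdj u≢v rewrite ==-≢ u≢v = refl

  closedAdj-cases : ∀ {u v} → closedAdj E u v ≡ true → u ≡ v ⊎ E u v ≡ true
  closedAdj-cases {u} {v} uv with u == v in u=v
  ... | true  = inj₁ (==⇒≡ u=v)
  ... | false = inj₂ uv

  closedAdj-sym : IsSimple E → ∀ u v → closedAdj E u v ≡ closedAdj E v u
  closedAdj-sym simple u v = cong₂ _∨_ (==-sym u v) (IsSimple.symmetric simple u v)

  reach-++ : ∀ a b {u v w} → reach E a u v ≡ true → reach E b v w ≡ true → reach E (a + b) u w ≡ true
  reach-++ zero    b {u} uv vw with refl ← ==⇒≡ {u = u} uv = vw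
  reach-++ (suc a) b {u} {v} {w} uv vw =
    let x , ux∧xv = anyF-true (λ x → E u x ∧ reach E a x v) uv
        ux , xv   = ∧-true ux∧xv
    in anyF-intro (λ x → E u x ∧ reach E (a + b) x w) x (cong₂ _∧_ ux (reach-++ a b xv vw))

  private
    distFrom-≤ : ∀ fuel s k {u v} → s ≤ k → reach E k u v ≡ true → distFrom E fuel s u v ≤ k
    distFrom-≤ zero       s k s≤k _  = s≤k
    distFrom-≤ (suc fuel) s k {u} {v} s≤k uv with reach E s u v in us
    ... | true  = s≤k
    ... | false with m≤n⇒m<n∨m≡n s≤k
    ...   | inj₁ s<k  = distFrom-≤ fuel (suc s) k s<k uv
    ...   | inj₂ refl = contradiction (trans (sym uv) us) λ ()

    distFrom-reached : ∀ fuel s u v →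
                       distFrom E fuel s u v ≡ s + fuel ⊎ reach E (distFrom E fuel s u v) u v ≡ true
    distFrom-reached zero       s u v = inj₁ (sym (+-identityʳ s))
    distFrom-reached (suc fuel) s u v with reach E s u v in us
    ... | true  = inj₂ us
    ... | false with distFrom-reached fuel (suc s) u v
    ...   | inj₁ exhausted = inj₁ (trans exhausted (sym (+-suc s fuel)))
    ...   | inj₂ reached   = inj₂ reached

    distFrom-≤-bound : ∀ fuel s u v → distFrom E fuel s u v ≤ s + fuel
    distFrom-≤-bound zero       s u v = ≤-reflexive (sym (+-identityʳ s))
    distFrom-≤-bound (suc fuel) s u v with reach E s u v
    ... | true  = m≤m+n s (suc fuel)
    ... | false = ≤-trans (distFrom-≤-bound fuel (suc s) u v) (≤-reflexive (sym (+-suc s fuel)))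

  dist-≤ : ∀ k {u v} → reach E k u v ≡ true → dist E u v ≤ k
  dist-≤ k = distFrom-≤ N 0 k z≤n

  dist-≤N : ∀ u v → dist E u v ≤ N
  dist-≤N = distFrom-≤-bound N 0

  dist-reached : ∀ u v → dist E u v ≡ N ⊎ reach E (dist E u v) u v ≡ true
  dist-reached = distFrom-reached N 0

  -- The bound m ≤ N is needed because dist returns N for unreachable pairs.
  dist-≥ : ∀ m {u v} → m ≤ N → (∀ j → j < m → reach E j u v ≡ false) → m ≤ dist E u v
  dist-≥ m {u} {v} m≤N noWalk with dist-reached u v
  ... | inj₁ unreachable = subst (m ≤_) (sym unreachable) m≤N
  ... | inj₂ reached with m ≤? dist E u v
  ...   | yes m≤d = m≤d
  ...   | no  m≰d = contradiction (trans (sym reached) (noWalk _ (≰⇒> m≰d))) λ ()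

  dist-refl : ∀ u → dist E u u ≡ 0
  dist-refl u = n≤0⇒n≡0 (dist-≤ 0 (==-refl u))

  ≢⇒1≤dist : ∀ {u v} → u ≢ v → 1 ≤ dist E u v
  ≢⇒1≤dist {u} {v} u≢v = dist-≥ 1 (nonempty u) λ { zero _ → ==-≢ u≢v ; (suc _) (s≤s ()) }
    where
    nonempty : ∀ {M} → Fin M → 1 ≤ M
    nonempty {suc _} _ = s≤s z≤n

  dist-triangle : ∀ u v w → dist E u w ≤ dist E u v + dist E v w
  dist-triangle u v w with dist-reached u v | dist-reached v w
  ... | inj₁ uv≡N | _         =
    subst (λ d → dist E u w ≤ d + dist E v w) (sym uv≡N) (≤-trans (dist-≤N u w) (m≤m+n N _))
  ... | inj₂ _    | inj₁ vw≡N =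
    subst (λ d → dist E u w ≤ dist E u v + d) (sym vw≡N) (≤-trans (dist-≤N u w) (m≤n+m N _))
  ... | inj₂ uv   | inj₂ vw   = dist-≤ _ (reach-++ (dist E u v) (dist E v w) uv vw)

  closedAdj⇒dist≤1 : ∀ {u v} → closedAdj E u v ≡ true → dist E u v ≤ 1
  closedAdj⇒dist≤1 {u} uv with closedAdj-cases uv
  ... | inj₁ refl = subst (_≤ 1) (sym (dist-refl u)) z≤n
  ... | inj₂ adj  = dist-≤ 1 (anyF-intro (λ w → E u w ∧ reach E 0 w _) _ (cong₂ _∧_ adj (==-refl _)))

  closedNbhd⊆⇒dist≤ : ∀ {x y z} → (∀ w → closedAdj E x w ≡ true → closedAdj E y w ≡ true) →
                      z ≢ x → dist E y z ≤ dist E x z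
  closedNbhd⊆⇒dist≤ {x} {y} {z} x⊆y z≢x with dist-reached x z
  ... | inj₁ unreachable = subst (dist E y z ≤_) (sym unreachable) (dist-≤N y z)
  ... | inj₂ reached with dist E x z
  ...   | zero  = contradiction (sym (==⇒≡ reached)) z≢x
  ...   | suc d with anyF-true (λ w → E x w ∧ reach E d w z) reached
  ...     | w , xw∧wz with ∧-true xw∧wz
  ...       | xw , wz with closedAdj-cases (x⊆y w (adj⇒closedAdj xw))
  ...         | inj₁ refl = m≤n⇒m≤1+n (dist-≤ d wz)
  ...         | inj₂ yw   = dist-≤ (suc d) (anyF-intro (λ w → E y w ∧ reach E d w z) w (cong₂ _∧_ yw wz))

  commonClosedNeighbour⇒dist≤2 : IsSimple E → ∀ {u v w} →
    closedAdj E u w ≡ true → closedAdj E v w ≡ true → dist E u v ≤ 2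
  commonClosedNeighbour⇒dist≤2 simple {u} {v} {w} uw vw = ≤-trans (dist-triangle u w v)
    (+-mono-≤ (closedAdj⇒dist≤1 uw) (closedAdj⇒dist≤1 (trans (closedAdj-sym simple w v) vw)))

  walk≤2⇒commonClosedNeighbour : IsSimple E → ∀ j {u v} → j ≤ 2 → reach E j u v ≡ true →
    ∃ λ w → closedAdj E u w ≡ true × closedAdj E v w ≡ true
  walk≤2⇒commonClosedNeighbour simple zero {u} _ uv with refl ← ==⇒≡ {u = u} uv =
    u , closedAdj-refl u , closedAdj-refl u
  walk≤2⇒commonClosedNeighbour simple (suc zero) {u} {v} _ uv
    with w , uw∧wv ← anyF-true (λ w → E u w ∧ reach E 0 w v) uv
    with uw , wv ← ∧-true uw∧wv
    with refl ← ==⇒≡ {u = w} {v} wv =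
    w , adj⇒closedAdj uw , closedAdj-refl w
  walk≤2⇒commonClosedNeighbour simple (suc (suc zero)) {u} {v} _ uv
    with w , uw∧wv ← anyF-true (λ w → E u w ∧ reach E 1 w v) uv
    with uw , wv ← ∧-true uw∧wv
    with x , wx∧xv ← anyF-true (λ x → E w x ∧ reach E 0 x v) wv
    with wx , xv ← ∧-true wx∧xv
    with refl ← ==⇒≡ {u = x} {v} xv =
    w , adj⇒closedAdj uw , adj⇒closedAdj (trans (IsSimple.symmetric simple v w) wx)
  walk≤2⇒commonClosedNeighbour simple (suc (suc (suc _))) (s≤s (s≤s ())) _

-- sameBlockB as a relation: δ = false for twins, δ = true for a γ-pair.
SameBlock : ∀ {N} → Graph N → Fin N → Fin N → Set
SameBlock E u v = Σ[ δ ∈ Bool ] (∀ w → closedAdj E v w ≡ δ xor closedAdj E u w)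

GammaPair : ∀ {N} → Graph N → Fin N → Fin N → Set
GammaPair E u v = ∀ w → closedAdj E v w ≡ not (closedAdj E u w)

module _ {N} (E : Graph N) where

  sameBlock-refl : ∀ u → SameBlock E u u
  sameBlock-refl u = false , λ _ → refl

  sameBlock-sym : ∀ {u v} → SameBlock E u v → SameBlock E v u
  sameBlock-sym (δ , uv) = δ , λ w → xor-cancelˡ δ (sym (uv w))

  sameBlock-trans : ∀ {u v x} → SameBlock E u v → SameBlock E v x → SameBlock E u x
  sameBlock-trans (δ , uv) (ε , vx) =
    ε xor δ , λ w → trans (vx w) (trans (cong (ε xor_) (uv w)) (sym (xor-assoc ε δ _)))

  sameBlockB⇒SameBlock : ∀ {u v} → sameBlockB E u v ≡ true → SameBlock E u v
  sameBlockB⇒SameBlock {u} {v} uv with twinsB E u v in twins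
  ... | true  = false , λ w → xnor⇒≡ (allF-true _ twins w)
  ... | false = true , λ w → xor⇒≡not (allF-true _ uv w)

  SameBlock⇒sameBlockB : ∀ {u v} → SameBlock E u v → sameBlockB E u v ≡ true
  SameBlock⇒sameBlockB {u} {v} (false , uv)
    rewrite allF-intro (λ w → not (closedAdj E u w xor closedAdj E v w)) (λ w → xnor-≡ (sym (uv w))) = refl
  SameBlock⇒sameBlockB {u} {v} (true , uv)
    rewrite allF-intro (λ w → closedAdj E u w xor closedAdj E v w)
                       (λ w → trans (cong (closedAdj E u w xor_) (uv w)) (xor-inverseʳ (closedAdj E u w)))
    = ∨-zeroʳ _

  gammaPair-sym : ∀ {u v} → GammaPair E u v → GammaPair E v u
  gammaPair-sym γ w = trans (sym (not-involutive _)) (cong not (sym (γ w)))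

  gammaPairB⇒GammaPair : ∀ {u v} → gammaPairB E u v ≡ true → GammaPair E u v
  gammaPairB⇒GammaPair uv w = xor⇒≡not (allF-true _ uv w)

  ¬gammaPairB⇒witness : ∀ {u v} → gammaPairB E u v ≡ false → ∃ λ w → closedAdj E u w ≡ closedAdj E v w
  ¬gammaPairB⇒witness uv = let w , uw⊕vw = allF-false _ uv in w , xor-false⇒≡ uw⊕vw

  gammaPair-disjoint : ∀ {u v w} → GammaPair E u v → closedAdj E u w ≡ true → closedAdj E v w ≡ true → ⊥
  gammaPair-disjoint {w = w} γ uw vw = contradiction (trans (sym vw) (trans (γ w) (cong not uw))) λ ()

  gammaPair⇒≢ : ∀ {u v} → GammaPair E u v → u ≢ v
  gammaPair⇒≢ {u} γ refl = gammaPair-disjoint γ (closedAdj-refl E u) (closedAdj-refl E u)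

  gammaPair⇒3≤dist : IsSimple E → 3 ≤ N → ∀ {u v} → GammaPair E u v → 3 ≤ dist E u v
  gammaPair⇒3≤dist simple 3≤N γ = dist-≥ E 3 3≤N λ j j<3 → ¬-not λ walk →
    let w , uw , vw = walk≤2⇒commonClosedNeighbour E simple j (≤-pred j<3) walk
    in gammaPair-disjoint γ uw vw

  isRep-minimal : ∀ {v} → isRep E v ≡ true → ∀ w → toℕ w < toℕ v → sameBlockB E w v ≡ false
  isRep-minimal {v} rep w w<v with allF-true _ rep w
  ... | notEarlier with toℕ w <ᵇ toℕ v | <⇒<ᵇ w<v
  ...   | true | _ with sameBlockB E w v
  ...     | false = refl
  ...     | true  = contradiction notEarlier λ ()

  isRep-witness : ∀ {v} → isRep E v ≡ false → ∃ λ w → toℕ w < toℕ v × sameBlockB E w v ≡ true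
  isRep-witness {v} notRep with allF-false _ notRep
  ... | w , earlier with toℕ w <ᵇ toℕ v in w<ᵇv | sameBlockB E w v in wv
  ...   | true  | true  = w , <ᵇ⇒< (toℕ w) (toℕ v) (subst T (sym w<ᵇv) _) , wv
  ...   | true  | false = contradiction earlier λ ()
  ...   | false | _     = contradiction earlier λ ()

  rep-unique : ∀ {v v′} → isRep E v ≡ true → isRep E v′ ≡ true → SameBlock E v v′ → v ≡ v′
  rep-unique {v} {v′} rep rep′ vv′ with <-cmp (toℕ v) (toℕ v′)
  ... | tri≈ _ v≡v′ _ = toℕ-injective v≡v′
  ... | tri< v<v′ _ _ =
    contradiction (trans (sym (SameBlock⇒sameBlockB vv′)) (isRep-minimal rep′ v v<v′)) λ ()
  ... | tri> _ _ v′<v =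
    contradiction (trans (sym (SameBlock⇒sameBlockB (sameBlock-sym vv′))) (isRep-minimal rep v′ v′<v)) λ ()

  rep-exists : ∀ w → ∃ λ v → isRep E v ≡ true × SameBlock E w v
  rep-exists w = below (suc (toℕ w)) w ≤-refl
    where
    below : ∀ b w → toℕ w < b → ∃ λ v → isRep E v ≡ true × SameBlock E w v
    below (suc b) w w<b with isRep E w in rep
    ... | true  = w , rep , sameBlock-refl w
    ... | false with isRep-witness rep
    ...   | u , u<w , uw with below b u (≤-trans u<w (≤-pred w<b))
    ...     | v , repv , uv = v , repv , sameBlock-trans (sameBlock-sym (sameBlockB⇒SameBlock uw)) uv

  countF-rep : ∀ w → countF (λ v → isRep E v ∧ sameBlockB E w v) ≡ 1
  countF-rep w = let r , repr , wr = rep-exists w in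
    countF≡1 _ r (cong₂ _∧_ repr (SameBlock⇒sameBlockB wr)) λ v repv∧wv →
      let repv , wv = ∧-true repv∧wv in
      rep-unique repv repr (sameBlock-trans (sameBlock-sym (sameBlockB⇒SameBlock wv)) wr)

  sumOverBlocks-blockSize : sumOverBlocks E (λ t → t) ≡ N
  sumOverBlocks-blockSize =
    trans (sumF-cong blockTerm) (double-counting (λ v w → isRep E v ∧ sameBlockB E w v) countF-rep)
    where
    blockTerm : ∀ v → (if isRep E v then blockSize E v else 0) ≡ countF (λ w → isRep E v ∧ sameBlockB E w v)
    blockTerm v with isRep E v
    ... | true  = refl
    ... | false = sym (sumF-zero N)

  sumOverBlocks-*ʳ : ∀ c → sumOverBlocks E (λ t → t * c) ≡ sumOverBlocks E (λ t → t) * c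
  sumOverBlocks-*ʳ c = trans (sumF-cong blockTerm) (sumF-*ʳ (λ v → if isRep E v then blockSize E v else 0) c)
    where
    blockTerm : ∀ v → (if isRep E v then blockSize E v * c else 0) ≡ (if isRep E v then blockSize E v else 0) * c
    blockTerm v with isRep E v
    ... | true  = refl
    ... | false = refl

-- 3 ≤ N is only required once a vertex exists, so that the empty graph is covered too.
module StrongResolvingByBlocks {N} (E : Graph N) (simple : IsSimple E) (3≤N : Fin N → 3 ≤ N)
  (diameter≤3 : ∀ u v → dist E u v ≤ 3)
  (near-or-gammaPair : ∀ u v → dist E u v ≤ 2 ⊎ GammaPair E u v) where

  sameBlock-notBetween : ∀ {x y z} → SameBlock E x y → x ≢ y → z ≢ x →
                         dist E y z ≢ dist E y x + dist E x z
  sameBlock-notBetween {x} {y} {z} (false , twins) x≢y z≢x yz≡yx+xz = <⇒≱ yz<yx+xz yz≥yx+xz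
    where
    yz≥yx+xz = ≤-reflexive (sym yz≡yx+xz)
    yz<yx+xz : dist E y z < dist E y x + dist E x z
    yz<yx+xz = ≤-trans (s≤s (closedNbhd⊆⇒dist≤ E (λ w xw → trans (twins w) xw) z≢x))
                       (+-monoˡ-≤ (dist E x z) (≢⇒1≤dist E (x≢y ∘ sym)))
  sameBlock-notBetween {x} {y} {z} (true , γ) x≢y z≢x yz≡yx+xz = <⇒≱ yz<yx+xz yz≥yx+xz
    where
    yz≥yx+xz = ≤-reflexive (sym yz≡yx+xz)
    yz<yx+xz : dist E y z < dist E y x + dist E x z
    yz<yx+xz = ≤-trans (s≤s (diameter≤3 y z))
                       (+-mono-≤ (gammaPair⇒3≤dist E simple (3≤N x) (gammaPair-sym E γ))
                                 (≢⇒1≤dist E (z≢x ∘ sym)))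

  sameBlock-unresolved : ∀ {x y z} → SameBlock E x y → x ≢ y → z ≢ x → z ≢ y →
                         ¬ StronglyResolves E z x y
  sameBlock-unresolved xy x≢y z≢x z≢y (inj₁ x-between) = sameBlock-notBetween xy x≢y z≢x x-between
  sameBlock-unresolved xy x≢y z≢x z≢y (inj₂ y-between) =
    sameBlock-notBetween (sameBlock-sym E xy) (x≢y ∘ sym) z≢y y-between

  -- y lies in exactly one of N[x], N[z]; it reaches the other vertex of the γ-pair in two steps
  -- unless it forms a γ-pair with it, which would put y into the block of x.
  between-gammaPair : ∀ {x y z} → GammaPair E x z → ¬ SameBlock E x y →
                      dist E x z ≡ dist E x y + dist E y z
  between-gammaPair {x} {y} {z} γ ¬xy =
    ≤-antisym (dist-triangle E x y z) (≤-trans via-y≤3 (gammaPair⇒3≤dist E simple (3≤N x) γ))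
    where
    via-y≤3 : dist E x y + dist E y z ≤ 3
    via-y≤3 with closedAdj E x y in xy | near-or-gammaPair y z | near-or-gammaPair x y
    ... | true  | inj₁ yz≤2 | _ = +-mono-≤ (closedAdj⇒dist≤1 E xy) yz≤2
    ... | true  | inj₂ γyz  | _ = ⊥-elim (¬xy (sameBlock-trans E (true , γ) (sameBlock-sym E (true , γyz))))
    ... | false | _ | inj₂ γxy  = ⊥-elim (¬xy (true , γxy))
    ... | false | _ | inj₁ xy≤2 = +-mono-≤ xy≤2 (closedAdj⇒dist≤1 E yz)
      where
      yz : closedAdj E y z ≡ true
      yz = trans (closedAdj-sym E simple y z) (trans (γ y) (cong not xy))

  module _ (R : Fin N → Bool)
           (R-covers : ∀ v → ∃ λ r → R r ≡ true × SameBlock E v r)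
           (R-unique : ∀ {r r′} → R r ≡ true → R r′ ≡ true → SameBlock E r r′ → r ≡ r′)
           (gammaPartner : ∀ v → ∃ (GammaPair E v)) where

    resolving-lower-bound : ∀ S → IsStrongResolvingSet E S → N ∸ countF R ≤ ∣ S ∣
    resolving-lower-bound S resolving = begin
      N ∸ countF R                        ≤⟨ ∸-monoʳ-≤ N outside≤R ⟩
      N ∸ countF (not ∘ lookup S)
        ≡⟨ cong (_∸ countF (not ∘ lookup S)) (sym (countF-not (lookup S))) ⟩
      countF (lookup S) + countF (not ∘ lookup S) ∸ countF (not ∘ lookup S)
        ≡⟨ m+n∸n≡m (countF (lookup S)) (countF (not ∘ lookup S)) ⟩
      countF (lookup S)                   ≡⟨ size≡countF S ⟨
      ∣ S ∣                               ∎
      where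
      open ≤-Reasoning
      ∈S⇒≢ : ∀ {z w} → z ∈ S → lookup S w ≡ false → z ≢ w
      ∈S⇒≢ z∈S w∉S refl = contradiction (trans (sym ([]=⇒lookup z∈S)) w∉S) λ ()
      outsideDistinct : ∀ {u v} → not (lookup S u) ≡ true → not (lookup S v) ≡ true →
                        SameBlock E u v → u ≡ v
      outsideDistinct {u} {v} u∉S v∉S uv with u ≟ v
      ... | yes u≡v = u≡v
      ... | no  u≢v = let z , z∈S , resolves = resolving u v u≢v in
        ⊥-elim (sameBlock-unresolved uv u≢v (∈S⇒≢ z∈S (not-injective u∉S)) (∈S⇒≢ z∈S (not-injective v∉S))
                                     resolves)
      outside≤R : countF (not ∘ lookup S) ≤ countF R
      outside≤R = countF-≤-matching (not ∘ lookup S) R (sameBlockB E)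
        (λ v _ → let r , Rr , vr = R-covers v in r , Rr , SameBlock⇒sameBlockB E vr)
        (λ r _ → countF≤1 _ λ u v u∉S∧ur v∉S∧vr →
           let u∉S , ur = ∧-true u∉S∧ur
               v∉S , vr = ∧-true v∉S∧vr
           in outsideDistinct u∉S v∉S
                (sameBlock-trans E (sameBlockB⇒SameBlock E ur) (sameBlock-sym E (sameBlockB⇒SameBlock E vr))))

    outsideR : Subset N
    outsideR = tabulate (not ∘ R)

    ∉R⇒∈outsideR : ∀ {z} → R z ≡ false → z ∈ outsideR
    ∉R⇒∈outsideR {z} Rz = lookup⇒[]= z outsideR (trans (lookup∘tabulate (not ∘ R) z) (cong not Rz))

    endpoint : ∀ u v → dist E u v ≡ dist E u v + dist E v v
    endpoint u v = sym (trans (cong (dist E u v +_) (dist-refl E v)) (+-identityʳ _))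

    outsideR-resolving : IsStrongResolvingSet E outsideR
    outsideR-resolving x y x≢y with R x in Rx | R y in Ry
    ... | false | _     = x , ∉R⇒∈outsideR Rx , inj₁ (endpoint y x)
    ... | true  | false = y , ∉R⇒∈outsideR Ry , inj₂ (endpoint x y)
    ... | true  | true  = z , ∉R⇒∈outsideR Rz , inj₂ (between-gammaPair γ ¬xy)
      where
      z = proj₁ (gammaPartner x)
      γ = proj₂ (gammaPartner x)
      Rz : R z ≡ false
      Rz = ¬-not λ Rz → gammaPair⇒≢ E γ (R-unique Rx Rz (true , γ))
      ¬xy : ¬ SameBlock E x y
      ¬xy xy = x≢y (R-unique Rx Ry xy)

    size-outsideR : ∣ outsideR ∣ ≡ N ∸ countF R
    size-outsideR = begin
      ∣ outsideR ∣                             ≡⟨ size≡countF outsideR ⟩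
      countF (lookup outsideR)                 ≡⟨ sumF-cong (cong indicator ∘ lookup∘tabulate (not ∘ R)) ⟩
      countF (not ∘ R)                         ≡⟨ m+n∸m≡n (countF R) (countF (not ∘ R)) ⟨
      countF R + countF (not ∘ R) ∸ countF R   ≡⟨ cong (_∸ countF R) (countF-not R) ⟩
      N ∸ countF R                             ∎
      where open ≡-Reasoning

    strongMetricDim : IsStrongMetricDim E (N ∸ countF R)
    strongMetricDim = (outsideR , outsideR-resolving , size-outsideR) , resolving-lower-bound

module Modular {NG NH} (G : Graph NG) (H : Graph NH) where

  P : Graph (NG * NH)
  P = modular G H

  _⊗_ : Fin NG → Fin NH → Fin (NG * NH)
  g ⊗ h = combine g h

  fst : Fin (NG * NH) → Fin NG
  fst x = proj₁ (remQuot {NG} NH x)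

  snd : Fin (NG * NH) → Fin NH
  snd x = proj₂ (remQuot {NG} NH x)

  fst-⊗ : ∀ g h → fst (g ⊗ h) ≡ g
  fst-⊗ g h = cong proj₁ (remQuot-combine g h)

  snd-⊗ : ∀ g h → snd (g ⊗ h) ≡ h
  snd-⊗ g h = cong proj₂ (remQuot-combine g h)

  ≡-coords : ∀ {x y} → fst x ≡ fst y → snd x ≡ snd y → x ≡ y
  ≡-coords {x} {y} g≡ h≡ =
    trans (sym (combine-remQuot {NG} NH x)) (trans (cong₂ _⊗_ g≡ h≡) (combine-remQuot {NG} NH y))

  ==-coords : ∀ x y → (x == y) ≡ ((fst x == fst y) ∧ (snd x == snd y))
  ==-coords x y with x ≟ y
  ... | yes refl rewrite ==-refl (fst x) | ==-refl (snd x) = refl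
  ... | no x≢y with fst x ≟ fst y | snd x ≟ snd y
  ...   | yes g≡ | yes h≡ = contradiction (≡-coords g≡ h≡) x≢y
  ...   | yes _  | no _   = refl
  ...   | no _   | _      = refl

  closedAdj-modular : ∀ x y → closedAdj P x y ≡ not (closedAdj G (fst x) (fst y) xor closedAdj H (snd x) (snd y))
  closedAdj-modular x y rewrite ==-coords x y =
    truthTable (fst x == fst y) (snd x == snd y) (G (fst x) (fst y)) (H (snd x) (snd y))
    where
    truthTable : ∀ e f a b →
      ((e ∧ f) ∨ (e ∧ b) ∨ (a ∧ f) ∨ (a ∧ b) ∨ (not e ∧ not f ∧ not a ∧ not b))
        ≡ not ((e ∨ a) xor (f ∨ b))
    truthTable true  true  a     b     = refl
    truthTable true  false true  true  = refl
    truthTable true  false true  false = refl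
    truthTable true  false false true  = refl
    truthTable true  false false false = refl
    truthTable false true  true  b     = refl
    truthTable false true  false b     = refl
    truthTable false false true  true  = refl
    truthTable false false true  false = refl
    truthTable false false false true  = refl
    truthTable false false false false = refl

  closedAdj-modular-⊗ : ∀ x g h → closedAdj P x (g ⊗ h) ≡ not (closedAdj G (fst x) g xor closedAdj H (snd x) h)
  closedAdj-modular-⊗ x g h = trans (closedAdj-modular x (g ⊗ h))
    (cong₂ (λ g′ h′ → not (closedAdj G (fst x) g′ xor closedAdj H (snd x) h′)) (fst-⊗ g h) (snd-⊗ g h))

  closedAdj-modular-agree : ∀ {x g h} → closedAdj G (fst x) g ≡ closedAdj H (snd x) h →
                            closedAdj P x (g ⊗ h) ≡ true
  closedAdj-modular-agree {x} {g} {h} agree = trans (closedAdj-modular-⊗ x g h) (xnor-≡ agree)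

  modular-isSimple : IsSimple G → IsSimple H → IsSimple P
  modular-isSimple simpleG simpleH = record { symmetric = symmetric ; irreflexive = irreflexive }
    where
    irreflexive : ∀ x → P x x ≡ false
    irreflexive x rewrite ==-refl (fst x) | ==-refl (snd x)
                        | IsSimple.irreflexive simpleG (fst x) | IsSimple.irreflexive simpleH (snd x) = refl
    symmetric : ∀ x y → P x y ≡ P y x
    symmetric x y with x ≟ y
    ... | yes refl = refl
    ... | no  x≢y  = begin
      P x y                ≡⟨ adj≡closedAdj P x≢y ⟩
      closedAdj P x y      ≡⟨ closedAdj-modular x y ⟩
      not (closedAdj G (fst x) (fst y) xor closedAdj H (snd x) (snd y))
        ≡⟨ cong₂ (λ a b → not (a xor b)) (closedAdj-sym G simpleG (fst x) (fst y))
                                         (closedAdj-sym H simpleH (snd x) (snd y)) ⟩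
      not (closedAdj G (fst y) (fst x) xor closedAdj H (snd y) (snd x))
        ≡⟨ closedAdj-modular y x ⟨
      closedAdj P y x      ≡⟨ adj≡closedAdj P (x≢y ∘ sym) ⟨
      P y x                ∎
      where open ≡-Reasoning

  sameBlock-modular : ∀ {x y} → SameBlock G (fst x) (fst y) → SameBlock H (snd x) (snd y) → SameBlock P x y
  sameBlock-modular {x} {y} (δ , gg) (ε , hh) = δ xor ε , λ w → begin
    closedAdj P y w
      ≡⟨ closedAdj-modular y w ⟩
    not (closedAdj G (fst y) (fst w) xor closedAdj H (snd y) (snd w))
      ≡⟨ cong₂ (λ a b → not (a xor b)) (gg (fst w)) (hh (snd w)) ⟩
    not ((δ xor closedAdj G (fst x) (fst w)) xor (ε xor closedAdj H (snd x) (snd w)))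
      ≡⟨ cong not (xor-interchange δ ε _ _) ⟩
    not ((δ xor ε) xor (closedAdj G (fst x) (fst w) xor closedAdj H (snd x) (snd w)))
      ≡⟨ not-distribʳ-xor (δ xor ε) _ ⟩
    (δ xor ε) xor not (closedAdj G (fst x) (fst w) xor closedAdj H (snd x) (snd w))
      ≡⟨ cong ((δ xor ε) xor_) (closedAdj-modular x w) ⟨
    (δ xor ε) xor closedAdj P x w
      ∎
    where
    open ≡-Reasoning
    xor-interchange : ∀ δ ε a b → (δ xor a) xor (ε xor b) ≡ (δ xor ε) xor (a xor b)
    xor-interchange false false a b = refl
    xor-interchange false true  a b = sym (not-distribʳ-xor a b)
    xor-interchange true  false a b = sym (not-distribˡ-xor a b)
    xor-interchange true  true  a b = xor-annihilates-not a b

  sameBlock-modular⁻¹ : ∀ {x y} → SameBlock P x y → SameBlock G (fst x) (fst y) × SameBlock H (snd x) (snd y)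
  sameBlock-modular⁻¹ {x} {y} (δ , xy) = (not cH-yx xor δ , G-part) , (not cG-yx xor δ , H-part)
    where
    cG-yx = closedAdj G (fst y) (fst x)
    cH-yx = closedAdj H (snd y) (snd x)
    G-part : ∀ g → closedAdj G (fst y) g ≡ (not cH-yx xor δ) xor closedAdj G (fst x) g
    G-part g = trans (xnor-solveˡ (closedAdj G (fst y) g) cH-yx yRow) (sym (xor-assoc (not cH-yx) δ _))
      where
      xRow : closedAdj P x (g ⊗ snd x) ≡ closedAdj G (fst x) g
      xRow rewrite closedAdj-modular-⊗ x g (snd x) | closedAdj-refl H (snd x) = not-xor-true _
      yRow : not (closedAdj G (fst y) g xor cH-yx) ≡ δ xor closedAdj G (fst x) g
      yRow = trans (sym (closedAdj-modular-⊗ y g (snd x))) (trans (xy (g ⊗ snd x)) (cong (δ xor_) xRow))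
    H-part : ∀ h → closedAdj H (snd y) h ≡ (not cG-yx xor δ) xor closedAdj H (snd x) h
    H-part h = trans (xnor-solveʳ cG-yx (closedAdj H (snd y) h) yColumn) (sym (xor-assoc (not cG-yx) δ _))
      where
      xColumn : closedAdj P x (fst x ⊗ h) ≡ closedAdj H (snd x) h
      xColumn rewrite closedAdj-modular-⊗ x (fst x) h | closedAdj-refl G (fst x) = not-involutive _
      yColumn : not (cG-yx xor closedAdj H (snd y) h) ≡ δ xor closedAdj H (snd x) h
      yColumn = trans (sym (closedAdj-modular-⊗ y (fst x) h)) (trans (xy (fst x ⊗ h)) (cong (δ xor_) xColumn))

  countF-modular : ∀ (p : Fin NG → Bool) (q : Fin NH → Bool) →
                   countF (λ x → p (fst x) ∧ q (snd x)) ≡ countF p * countF q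
  countF-modular p q = begin
    countF (λ x → p (fst x) ∧ q (snd x))
      ≡⟨ sumF-combine NG NH _ ⟩
    sumF (λ g → sumF (λ h → indicator (p (fst (g ⊗ h)) ∧ q (snd (g ⊗ h)))))
      ≡⟨ sumF-cong (λ g → sumF-cong λ h →
           cong₂ (λ g′ h′ → indicator (p g′ ∧ q h′)) (fst-⊗ g h) (snd-⊗ g h)) ⟩
    sumF (λ g → countF (λ h → p g ∧ q h))
      ≡⟨ sumF-cong (λ g → indicator-∧ (p g) q) ⟩
    sumF (λ g → indicator (p g) * countF q)
      ≡⟨ sumF-*ʳ (indicator ∘ p) (countF q) ⟩
    countF p * countF q
      ∎
    where
    open ≡-Reasoning
    indicator-∧ : ∀ b (q : Fin NH → Bool) → countF (λ h → b ∧ q h) ≡ indicator b * countF q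
    indicator-∧ true  q = sym (+-identityʳ (countF q))
    indicator-∧ false q = sumF-zero NH

module KnnMinusM {n} (3≤n : 3 ≤ n) {q r : Fin n → ℕ} (q≥1 : ∀ i → 1 ≤ q i) (r≥1 : ∀ i → 1 ≤ r i)
                 {N} {G : Graph N} (K : IsKnnMinusM n q r G) where
  open IsKnnMinusM K

  index : Fin N → Fin n
  index = proj₁ ∘ label

  side : Fin N → Bool
  side = proj₂ ∘ label

  closedAdj-label : ∀ u v → closedAdj G u v ≡ (index u == index v) xor (side u xor side v)
  closedAdj-label u v with u ≟ v
  ... | yes refl rewrite ==-refl (index u) | xor-same (side u) = refl
  ... | no u≢v   rewrite adjacent u v | ==-≢ u≢v = xor-by-cases (index u == index v) (side u xor side v)
    where
    xor-by-cases : ∀ a b → ((a ∧ not b) ∨ (not a ∧ b)) ≡ a xor b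
    xor-by-cases true  b = ∨-identityʳ (not b)
    xor-by-cases false b = refl

  closedAdj-otherIndex : ∀ {u v} → index u ≢ index v → closedAdj G u v ≡ side u xor side v
  closedAdj-otherIndex {u} {v} i≢j rewrite closedAdj-label u v | ==-≢ i≢j = refl

  closedAdj-sameIndex : ∀ {u v} → index u ≡ index v → closedAdj G u v ≡ not (side u xor side v)
  closedAdj-sameIndex {u} {v} i≡j rewrite closedAdj-label u v | i≡j | ==-refl (index v) = refl

  occupied : ∀ i s → ∃ λ v → ((index v == i) ∧ (if s then side v else not (side v))) ≡ true
  occupied i false = countF-positive _ (subst (1 ≤_) (sym (sizeX i)) (q≥1 i))
  occupied i true  = countF-positive _ (subst (1 ≤_) (sym (sizeY i)) (r≥1 i))

  vertexWith : Fin n → Bool → Fin N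
  vertexWith i s = proj₁ (occupied i s)

  index-vertexWith : ∀ i s → index (vertexWith i s) ≡ i
  index-vertexWith i s = ==⇒≡ (proj₁ (∧-true (proj₂ (occupied i s))))

  side-vertexWith : ∀ i s → side (vertexWith i s) ≡ s
  side-vertexWith i false = not-injective {y = false} (proj₂ (∧-true (proj₂ (occupied i false))))
  side-vertexWith i true  = proj₂ (∧-true (proj₂ (occupied i true)))

  closedAdj-vertexWith-other : ∀ {u k} σ → index u ≢ k → closedAdj G u (vertexWith k σ) ≡ side u xor σ
  closedAdj-vertexWith-other {u} {k} σ i≢k =
    trans (closedAdj-otherIndex (λ i≡ → i≢k (trans i≡ (index-vertexWith k σ))))
          (cong (side u xor_) (side-vertexWith k σ))

  closedAdj-vertexWith-same : ∀ u σ → closedAdj G u (vertexWith (index u) σ) ≡ not (side u xor σ)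
  closedAdj-vertexWith-same u σ =
    trans (closedAdj-sameIndex (sym (index-vertexWith (index u) σ)))
          (cong (λ t → not (side u xor t)) (side-vertexWith (index u) σ))

  closedAdj-shift : ∀ {u v} → index u ≡ index v →
                    ∀ w → closedAdj G v w ≡ (side u xor side v) xor closedAdj G u w
  closedAdj-shift {u} {v} i≡j w rewrite closedAdj-label u w | closedAdj-label v w | i≡j =
    xor-shift (index v == index w) (side u) (side v) (side w)
    where
    xor-shift : ∀ a s t σ → a xor (t xor σ) ≡ (s xor t) xor (a xor (s xor σ))
    xor-shift false false t σ = refl
    xor-shift false true  t σ = sym (xor-annihilates-not t σ)
    xor-shift true  false t σ = not-distribʳ-xor t σ
    xor-shift true  true  t σ = trans (not-distribˡ-xor t σ) (cong (not t xor_) (sym (not-involutive σ)))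

  sameIndex⇒sameBlock : ∀ {u v} → index u ≡ index v → SameBlock G u v
  sameIndex⇒sameBlock {u} {v} i≡j = side u xor side v , closedAdj-shift i≡j

  gammaPartner : ∀ u → ∃ (GammaPair G u)
  gammaPartner u = partner , λ w → trans (closedAdj-shift (sym (index-vertexWith (index u) (not (side u)))) w)
                                         (cong (_xor closedAdj G u w) sides)
    where
    partner = vertexWith (index u) (not (side u))
    sides : side u xor side partner ≡ true
    sides = trans (cong (side u xor_) (side-vertexWith (index u) (not (side u)))) (xor-inverseʳ (side u))

  realise : ∀ {u v} → index u ≢ index v →
            ∀ α β → ∃ λ w → closedAdj G u w ≡ α × closedAdj G v w ≡ β
  realise {u} {v} i≢j α β with avoid-two 3≤n (index u) (index v) | side v xor (side u xor α) ≟ᵇ β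
  ... | k , k≢i , k≢j | yes c≡β =
    vertexWith k σ , trans (closedAdj-vertexWith-other σ (k≢i ∘ sym)) (xor-xor (side u) α)
                   , trans (closedAdj-vertexWith-other σ (k≢j ∘ sym)) c≡β
    where σ = side u xor α
  ... | _ | no c≢β =
    vertexWith (index u) σ′ , trans (closedAdj-vertexWith-same u σ′) uw
                            , trans (closedAdj-vertexWith-other σ′ (i≢j ∘ sym)) vw
    where
    σ′ = not (side u xor α)
    uw : not (side u xor σ′) ≡ α
    uw = trans (not-distribʳ-xor (side u) σ′) (trans (cong (side u xor_) (not-involutive _)) (xor-xor (side u) α))
    vw : side v xor σ′ ≡ β
    vw = trans (sym (not-distribʳ-xor (side v) _)) (trans (cong not (¬-not c≢β)) (not-involutive β))

  realise₁ : ∀ u α → ∃ λ w → closedAdj G u w ≡ α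
  realise₁ u true  = u , closedAdj-refl G u
  realise₁ u false = let k , k≢i , _ = avoid-two 3≤n (index u) (index u) in
    vertexWith k (side u) , trans (closedAdj-vertexWith-other (side u) (k≢i ∘ sym)) (xor-same (side u))

  closedNeighbour-otherIndex : ∀ u → ∃ λ w → closedAdj G u w ≡ true × index u ≢ index w
  closedNeighbour-otherIndex u = let k , k≢i , _ = avoid-two 3≤n (index u) (index u) in
    vertexWith k (not (side u)) ,
    trans (closedAdj-vertexWith-other (not (side u)) (k≢i ∘ sym)) (xor-inverseʳ (side u)) ,
    λ i≡ → k≢i (trans (sym (index-vertexWith k (not (side u)))) (sym i≡))

  sameBlock⇒sameIndex : ∀ {u v} → SameBlock G u v → index u ≡ index v
  sameBlock⇒sameIndex {u} {v} (δ , uv) with index u ≟ index v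
  ... | yes i≡j = i≡j
  ... | no  i≢j = let w , uw , vw = realise i≢j false (not δ) in
    contradiction (trans (sym (trans (uv w) (trans (cong (δ xor_) uw) (xor-identityʳ δ)))) vw) (not-¬ refl)

  isSimple : IsSimple G
  isSimple = record { symmetric = symmetric ; irreflexive = irreflexive }
    where
    irreflexive : ∀ u → G u u ≡ false
    irreflexive u rewrite adjacent u u | ==-refl u = refl
    symmetric : ∀ u v → G u v ≡ G v u
    symmetric u v with u ≟ v
    ... | yes refl = refl
    ... | no  u≢v  = begin
      G u v                                        ≡⟨ adj≡closedAdj G u≢v ⟩
      closedAdj G u v                              ≡⟨ closedAdj-label u v ⟩
      (index u == index v) xor (side u xor side v)
        ≡⟨ cong₂ _xor_ (==-sym (index u) (index v)) (xor-comm (side u) (side v)) ⟩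
      (index v == index u) xor (side v xor side u) ≡⟨ closedAdj-label v u ⟨
      closedAdj G v u                              ≡⟨ adj≡closedAdj G (u≢v ∘ sym) ⟨
      G v u                                        ∎
      where open ≡-Reasoning

  kBlocks≡n : kBlocks G ≡ n
  kBlocks≡n = trans (sumF-cong repTerm) (double-counting (λ g i → isRep G g ∧ (index g == i)) oneRepPerIndex)
    where
    repTerm : ∀ g → indicator (isRep G g) ≡ countF (λ i → isRep G g ∧ (index g == i))
    repTerm g with isRep G g
    ... | true  = sym (countF≡1 _ (index g) (==-refl (index g)) (λ i g∈i → sym (==⇒≡ g∈i)))
    ... | false = sym (sumF-zero n)
    oneRepPerIndex : ∀ i → countF (λ g → isRep G g ∧ (index g == i)) ≡ 1
    oneRepPerIndex i = countF≡1 _ g (cong₂ _∧_ repg (≡⇒== g∈i)) λ h rep∧h∈i →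
        let reph , h∈i = ∧-true rep∧h∈i in
        rep-unique G reph repg (sameIndex⇒sameBlock (trans (==⇒≡ h∈i) (sym g∈i)))
      where
      rep = rep-exists G (vertexWith i false)
      g = proj₁ rep
      repg = proj₁ (proj₂ rep)
      g∈i : index g ≡ i
      g∈i = trans (sym (sameBlock⇒sameIndex (proj₂ (proj₂ rep)))) (index-vertexWith i false)

module ModularWithKnnMinusM {n} (3≤n : 3 ≤ n) {q r : Fin n → ℕ}
  (q≥1 : ∀ i → 1 ≤ q i) (r≥1 : ∀ i → 1 ≤ r i) {NG} {G : Graph NG} (K : IsKnnMinusM n q r G)
  {NH} (H : Graph NH) (simpleH : IsSimple H) where
  open KnnMinusM 3≤n q≥1 r≥1 K
  open Modular G H

  simpleP : IsSimple P
  simpleP = modular-isSimple isSimple simpleH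

  3≤|P| : Fin (NG * NH) → 3 ≤ NG * NH
  3≤|P| x = ≤-trans 3≤n (injective⇒≤ {f = λ i → vertexWith i false ⊗ snd x} λ {i} {j} eq →
    trans (sym (index-vertexWith i false))
          (trans (cong index (trans (sym (fst-⊗ _ (snd x))) (trans (cong fst eq) (fst-⊗ _ (snd x)))))
                 (index-vertexWith j false)))

  -- For different G-indices G realises any two closed-adjacency values in one column; for equal
  -- indices the column of w₀ is one in which x and y differ exactly by the G-shift δ.
  commonClosedNeighbour : ∀ {x y} → (∃ λ w → closedAdj P x w ≡ closedAdj P y w) →
                          ∃ λ w → closedAdj P x w ≡ true × closedAdj P y w ≡ true
  commonClosedNeighbour {x} {y} (w₀ , x≈y) with index (fst x) ≟ index (fst y)
  ... | no i≢j =
    let g , xg , yg = realise i≢j (closedAdj H (snd x) (snd x)) (closedAdj H (snd y) (snd x))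
    in g ⊗ snd x , closedAdj-modular-agree xg , closedAdj-modular-agree yg
  ... | yes i≡j =
    let g , xg = realise₁ (fst x) (closedAdj H (snd x) k)
    in g ⊗ k , closedAdj-modular-agree xg
             , closedAdj-modular-agree (trans (closedAdj-shift i≡j g) (trans (cong (δ xor_) xg) (sym yk)))
    where
    k = snd w₀
    δ = side (fst x) xor side (fst y)
    a = closedAdj G (fst x) (fst w₀)
    b = closedAdj H (snd x) k
    yk : closedAdj H (snd y) k ≡ δ xor b
    yk = begin
      closedAdj H (snd y) k               ≡⟨ xor-cancelˡ (δ xor a) (sym (not-injective agree)) ⟩
      (δ xor a) xor (a xor b)             ≡⟨ xor-assoc δ a _ ⟩
      δ xor (a xor (a xor b))             ≡⟨ cong (δ xor_) (xor-xor a b) ⟩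
      δ xor b                             ∎
      where
      open ≡-Reasoning
      agree : not (a xor b) ≡ not ((δ xor a) xor closedAdj H (snd y) k)
      agree = trans (sym (closedAdj-modular x w₀)) (trans x≈y (trans (closedAdj-modular y w₀)
                (cong (λ c → not (c xor closedAdj H (snd y) k)) (closedAdj-shift i≡j (fst w₀)))))

  near-or-gammaPair : ∀ x y → dist P x y ≤ 2 ⊎ GammaPair P x y
  near-or-gammaPair x y with gammaPairB P x y in γ
  ... | true  = inj₂ (gammaPairB⇒GammaPair P {x} {y} γ)
  ... | false = let w , xw , yw = commonClosedNeighbour {x} {y} (¬gammaPairB⇒witness P {x} {y} γ)
                in inj₁ (commonClosedNeighbour⇒dist≤2 P simpleP {x} {y} {w} xw yw)

  -- If {x, y} is a γ-pair, a closed neighbour w of x in another G-block cannot also form a γ-pair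
  -- with y (w would be a twin of x), so d(w, y) ≤ 2.
  diameter≤3 : ∀ x y → dist P x y ≤ 3
  diameter≤3 x y with near-or-gammaPair x y
  ... | inj₁ xy≤2 = m≤n⇒m≤1+n xy≤2
  ... | inj₂ γxy with closedNeighbour-otherIndex (fst x)
  ...   | g , xg , i≢ with near-or-gammaPair (g ⊗ snd x) y
  ...     | inj₁ wy≤2 = ≤-trans (dist-triangle P x (g ⊗ snd x) y)
                                (+-mono-≤ (closedAdj⇒dist≤1 P xw) wy≤2)
    where xw = closedAdj-modular-agree (trans xg (sym (closedAdj-refl H (snd x))))
  ...     | inj₂ γwy = contradiction (trans (sameBlock⇒sameIndex G-block) (cong index (fst-⊗ g (snd x)))) i≢
    where
    G-block = proj₁ (sameBlock-modular⁻¹ {x} {g ⊗ snd x}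
                (sameBlock-trans P {x} {y} {g ⊗ snd x} (true , γxy) (sameBlock-sym P {g ⊗ snd x} {y} (true , γwy))))

  reps : Fin (NG * NH) → Bool
  reps x = isRep G (fst x) ∧ isRep H (snd x)

  reps-cover : ∀ v → ∃ λ r → reps r ≡ true × SameBlock P v r
  reps-cover v with rep-exists G (fst v) | rep-exists H (snd v)
  ... | g , repg , vg | h , reph , vh =
    g ⊗ h ,
    trans (cong₂ (λ g′ h′ → isRep G g′ ∧ isRep H h′) (fst-⊗ g h) (snd-⊗ g h)) (cong₂ _∧_ repg reph) ,
    sameBlock-modular (subst (SameBlock G (fst v)) (sym (fst-⊗ g h)) vg)
                      (subst (SameBlock H (snd v)) (sym (snd-⊗ g h)) vh)

  reps-unique : ∀ {r r′} → reps r ≡ true → reps r′ ≡ true → SameBlock P r r′ → r ≡ r′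
  reps-unique rep rep′ rr′ =
    let repG , repH = ∧-true rep
        repG′ , repH′ = ∧-true rep′
        G-block , H-block = sameBlock-modular⁻¹ rr′
    in ≡-coords (rep-unique G repG repG′ G-block) (rep-unique H repH repH′ H-block)

  gammaPartnerP : ∀ v → ∃ (GammaPair P v)
  gammaPartnerP v = z , proj₂ (sameBlock-modular {v} {z} (true , G-γ) (false , H-same))
    where
    g = proj₁ (gammaPartner (fst v))
    z = g ⊗ snd v
    G-γ : GammaPair G (fst v) (fst z)
    G-γ w = trans (cong (λ g′ → closedAdj G g′ w) (fst-⊗ g (snd v))) (proj₂ (gammaPartner (fst v)) w)
    H-same : ∀ w → closedAdj H (snd z) w ≡ closedAdj H (snd v) w
    H-same w = cong (λ h → closedAdj H h w) (snd-⊗ g (snd v))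

  strongMetricDim : IsStrongMetricDim P (NG * NH ∸ n * kBlocks H)
  strongMetricDim = subst (λ m → IsStrongMetricDim P (NG * NH ∸ m)) countReps
    (StrongResolvingByBlocks.strongMetricDim P simpleP 3≤|P| diameter≤3 near-or-gammaPair
      reps reps-cover reps-unique gammaPartnerP)
    where
    countReps : countF reps ≡ n * kBlocks H
    countReps = trans (countF-modular (isRep G) (isRep H)) (cong (_* kBlocks H) kBlocks≡n)

proposition4p9 : (n : ℕ) → 3 ≤ n
    → (q r : Fin n → ℕ) → (∀ i → 1 ≤ q i) → (∀ i → 1 ≤ r i)
    → {NG : ℕ} (G : Graph NG) → IsKnnMinusM n q r G
    → {NH : ℕ} (H : Graph NH) → IsSimple H → NoUniversalVertex H
    → IsStrongMetricDim (modular G H)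
        (sumOverBlocks G (λ t → t * sumOverBlocks H (λ s → s)) ∸ n * kBlocks H)
proposition4p9 n 3≤n q r q≥1 r≥1 {NG} G K {NH} H simpleH _ =
  subst (IsStrongMetricDim (modular G H)) (sym (cong (_∸ n * kBlocks H) blockSums))
    (ModularWithKnnMinusM.strongMetricDim 3≤n q≥1 r≥1 K H simpleH)
  where
  open ≡-Reasoning
  blockSums : sumOverBlocks G (λ t → t * sumOverBlocks H (λ s → s)) ≡ NG * NH
  blockSums = begin
    sumOverBlocks G (λ t → t * sumOverBlocks H (λ s → s))  ≡⟨ sumOverBlocks-*ʳ G _ ⟩
    sumOverBlocks G (λ t → t) * sumOverBlocks H (λ s → s)  ≡⟨ cong₂ _*_ (sumOverBlocks-blockSize G)
                                                                         (sumOverBlocks-blockSize H) ⟩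
    NG * NH                                                ∎
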